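{- Let $k\ge2$. For every deterministic online algorithm $\mathcal{A}$ for $k$S2L-F there exists an instance on which $\mathrm{OPT}\ge\frac{2k}{k+\lfloor k/3\rfloor}\cdot P_{\mathcal{A}}$, where $P_{\mathcal{A}}$ is the number of requests accepted by $\mathcal{A}$. In other words, no deterministic online algorithm for $k$S2L-F has competitive ratio less than $\frac{2k}{k+\lfloor k/3\rfloor}$.
   Context: Problem $k$S2L (car sharing with two locations). There are two locations $0$ and $1$ and $k$ servers. Time is divided into stages $i=1,2,3,\dots$. A request of a stage is either a "(0,1)" (pick up at location 0, drop off at 1) or a "(1,0)". Each server serves at most one request per stage; a server that serves a (0,1) in stage $i$ can only be used for a (1,0) (or left unused) in stage $i+1$, and symmetrically; a server unused in stage $i$ may be moved for free and used in stage $i+1$ for either direction. Before stage 1 all servers count as unused. Formally, if $\ell_i,r_i$ are the numbers of accepted (0,1)'s and (1,0)'s in stage $i$ and $f_i=k-\ell_i-r_i$, with $\ell_0=r_0=0$, $f_0=k$, a choice is feasible iff for all $i\ge1$: $\ell_i$ (resp. $r_i$) is at most the number of (0,1) (resp. (1,0)) requests of stage $i$, $\ell_i\le r_{i-1}+f_{i-1}$, $r_i\le\ell_{i-1}+f_{i-1}$, $\ell_i+r_i\le k$. Profit = total number of accepted requests; OPT = maximum feasible profit of the (finite) instance. In $k$S2L-F, requests of each stage arrive one at a time (their number unknown to the algorithm) and each must be irrevocably accepted or rejected upon arrival, before the next arrives. The competitive ratio of an online algorithm is the worst case over instances of OPT divided by the algorithm's profit. -}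

module Defs where

open import Data.Nat using (ℕ; zero; suc; _+_; _*_; _∸_; _≤_; _<_)
open import Data.Bool using (Bool; true; false; if_then_else_)
open import Data.List using (List; []; _∷_; _∷ʳ_)
open import Data.Product using (_×_; _,_; Σ; ∃)
open import Data.Unit using (⊤)
open import Data.Empty using (⊥)
open import Relation.Binary.PropositionalEquality using (_≡_)

-- A request: (0,1) = pick up at 0, drop at 1; (1,0) = the reverse.
data Req : Set where
  r01 r10 : Req

Stage : Set
Stage = List Req

Instance : Set
Instance = List Stage

count01 : Stage → ℕ
count01 []          = 0
count01 (r01 ∷ rs)  = suc (count01 rs)
count01 (r10 ∷ rs)  = count01 rs

count10 : Stage → ℕ
count10 []          = 0
count10 (r01 ∷ rs)  = count10 rs
count10 (r10 ∷ rs)  = suc (count10 rs)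

-- A choice: for each stage i the pair (ℓ_i , r_i) of accepted (0,1)'s and (1,0)'s.
Choice : Set
Choice = List (ℕ × ℕ)

-- Feasibility with previous-stage data (ℓ_{i-1}, r_{i-1}, f_{i-1}).
FeasibleFrom : (k lp rp fp : ℕ) → Instance → Choice → Set
FeasibleFrom k lp rp fp []       []             = ⊤
FeasibleFrom k lp rp fp []       (_ ∷ _)        = ⊥
FeasibleFrom k lp rp fp (_ ∷ _)  []             = ⊥
FeasibleFrom k lp rp fp (s ∷ ss) ((l , r) ∷ cs) =
  l ≤ count01 s × r ≤ count10 s × l ≤ rp + fp × r ≤ lp + fp × l + r ≤ k
  × FeasibleFrom k l r (k ∸ (l + r)) ss cs

Feasible : ℕ → Instance → Choice → Set
Feasible k I c = FeasibleFrom k 0 0 k I c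

profit : Choice → ℕ
profit []             = 0
profit ((l , r) ∷ cs) = l + r + profit cs

IsOPT : ℕ → Instance → ℕ → Set
IsOPT k I o = (Σ Choice λ c → Feasible k I c × profit c ≡ o)
            × (∀ c → Feasible k I c → profit c ≤ o)

-- A deterministic online algorithm for kS2L-F: upon arrival of a request it
-- decides (true = accept) based on the completed stages so far, the requests
-- of the current stage that arrived before, and the current request.
-- (Its own previous decisions are determined by this history.)
OnlineAlg : Set
OnlineAlg = (past : List Stage) → (currentPrefix : Stage) → (current : Req) → Bool

accOne : Req → ℕ × ℕ
accOne r01 = (1 , 0)
accOne r10 = (0 , 1)

addP : ℕ × ℕ → ℕ × ℕ → ℕ × ℕ
addP (a , b) (c , d) = (a + c , b + d)

runStage : OnlineAlg → List Stage → Stage → Stage → ℕ × ℕ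
runStage A past pre []       = (0 , 0)
runStage A past pre (q ∷ qs) =
  addP (if A past pre q then accOne q else (0 , 0)) (runStage A past (pre ∷ʳ q) qs)

runFrom : OnlineAlg → List Stage → Instance → Choice
runFrom A past []       = []
runFrom A past (s ∷ ss) = runStage A past [] s ∷ runFrom A (past ∷ʳ s) ss

run : OnlineAlg → Instance → Choice
run A I = runFrom A [] I

-- The adversary opens stage 1 with k requests (0,1) and watches how many, x, the
-- algorithm accepts. If 2x ≤ k + ⌊k/3⌋ it stops: OPT = k. Otherwise it appends k
-- requests (1,0) to stage 1 and sends k requests (0,1) in stage 2, so OPT = 2k.
-- Having accepted ℓ₁ ≥ x of the (0,1)'s, the algorithm has only k − ℓ₁ servers at
-- location 0 in stage 2, whence its profit is at most 2k − ℓ₁ ≤ 2k − x ≤ k + ⌊k/3⌋.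
module Submission where

open import Defs
open import Data.Nat using (ℕ; zero; suc; _+_; _*_; _∸_; _/_; _%_; _≤_; _<_; z≤n; s≤s; _≤?_)
open import Data.Nat.Properties
open import Data.Nat.DivMod using (m≡m%n+[m/n]*n; m%n<n)
open import Data.Nat.Solver using (module +-*-Solver)
open import Data.Product using (Σ; _×_; _,_; proj₁; proj₂)
open import Data.List using ([]; _∷_; _∷ʳ_; _++_; length; replicate)
open import Data.Unit using (tt)
open import Data.Bool using (if_then_else_)
open import Relation.Nullary using (yes; no)
open import Relation.Binary.PropositionalEquality
open +-*-Solver

count01-replicate-r01 : ∀ n → count01 (replicate n r01) ≡ n
count01-replicate-r01 zero    = refl
count01-replicate-r01 (suc n) = cong suc (count01-replicate-r01 n)

count10-replicate-r01 : ∀ n → count10 (replicate n r01) ≡ 0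
count10-replicate-r01 zero    = refl
count10-replicate-r01 (suc n) = count10-replicate-r01 n

count10-replicate-r10 : ∀ n → count10 (replicate n r10) ≡ n
count10-replicate-r10 zero    = refl
count10-replicate-r10 (suc n) = cong suc (count10-replicate-r10 n)

count10-++ : ∀ xs ys → count10 (xs ++ ys) ≡ count10 xs + count10 ys
count10-++ []         ys = refl
count10-++ (r01 ∷ xs) ys = count10-++ xs ys
count10-++ (r10 ∷ xs) ys = cong suc (count10-++ xs ys)

runStage-proj₁-≤-++ : ∀ A past pre xs ys →
  proj₁ (runStage A past pre xs) ≤ proj₁ (runStage A past pre (xs ++ ys))
runStage-proj₁-≤-++ A past pre []       ys = z≤n
runStage-proj₁-≤-++ A past pre (q ∷ xs) ys =
  +-monoʳ-≤ (proj₁ (if A past pre q then accOne q else (0 , 0)))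
            (runStage-proj₁-≤-++ A past (pre ∷ʳ q) xs ys)

FeasibleFrom-profit-≤ : ∀ {k lp rp fp} I c →
  FeasibleFrom k lp rp fp I c → profit c ≤ length I * k
FeasibleFrom-profit-≤ []       []             _ = z≤n
FeasibleFrom-profit-≤ []       (_ ∷ _)        ()
FeasibleFrom-profit-≤ (_ ∷ _)  []             ()
FeasibleFrom-profit-≤ (_ ∷ I)  ((l , r) ∷ c) (_ , _ , _ , _ , l+r≤k , feas) =
  +-mono-≤ l+r≤k (FeasibleFrom-profit-≤ I c feas)

-- The ℓ₂ servers used in stage 2 for (0,1) come from the r₁ + f₁ = k − ℓ₁ servers
-- not used for (0,1) in stage 1.
two-stage-profit+ℓ₁-≤ : ∀ {k} s₁ s₂ {l₁ r₁ c₂} →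
  Feasible k (s₁ ∷ s₂ ∷ []) ((l₁ , r₁) ∷ c₂ ∷ []) →
  count10 s₂ ≡ 0 → profit ((l₁ , r₁) ∷ c₂ ∷ []) + l₁ ≤ 2 * k
two-stage-profit+ℓ₁-≤ {k} _ _ {l₁} {r₁} {l₂ , r₂}
  (_ , _ , _ , _ , l₁+r₁≤k , (_ , r₂≤0 , l₂≤r₁+f₁ , _)) no10 = begin
    l₁ + r₁ + (l₂ + r₂ + 0) + l₁          ≡⟨ cong (λ z → l₁ + r₁ + z + l₁) l₂+r₂+0≡l₂ ⟩
    l₁ + r₁ + l₂ + l₁                     ≤⟨ +-monoˡ-≤ l₁ (+-monoʳ-≤ (l₁ + r₁) l₂≤r₁+f₁) ⟩
    l₁ + r₁ + (r₁ + f₁) + l₁              ≡⟨ solve 4 (λ a r d l → a :+ (r :+ d) :+ l := a :+ d :+ (l :+ r))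
                                                refl (l₁ + r₁) r₁ f₁ l₁ ⟩
    l₁ + r₁ + f₁ + (l₁ + r₁)              ≡⟨ cong (_+ (l₁ + r₁)) (m+[n∸m]≡n l₁+r₁≤k) ⟩
    k + (l₁ + r₁)                         ≤⟨ +-monoʳ-≤ k l₁+r₁≤k ⟩
    k + k                                 ≡⟨ cong (k +_) (sym (+-identityʳ k)) ⟩
    2 * k                                 ∎
  where
    open ≤-Reasoning
    f₁ : ℕ
    f₁ = k ∸ (l₁ + r₁)
    l₂+r₂+0≡l₂ : l₂ + r₂ + 0 ≡ l₂
    l₂+r₂+0≡l₂ = trans (+-identityʳ _)
                   (trans (cong (l₂ +_) (n≤0⇒n≡0 (subst (r₂ ≤_) no10 r₂≤0))) (+-identityʳ l₂))

m≤[m/3]*3+2 : ∀ m → m ≤ (m / 3) * 3 + 2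
m≤[m/3]*3+2 m = begin
  m                    ≡⟨ m≡m%n+[m/n]*n m 3 ⟩
  m % 3 + (m / 3) * 3  ≤⟨ +-monoˡ-≤ ((m / 3) * 3) (≤-pred (m%n<n m 3)) ⟩
  2 + (m / 3) * 3      ≡⟨ +-comm 2 _ ⟩
  (m / 3) * 3 + 2      ∎
  where open ≤-Reasoning

m+m/3<2*n⇒m≤n+m/3 : ∀ m n → m + m / 3 < 2 * n → m ≤ n + m / 3
m+m/3<2*n⇒m≤n+m/3 m n h = ≤-pred (*-cancelˡ-< 2 m (suc (n + t)) 2m<2[n+t+1])
  where
    open ≤-Reasoning
    t : ℕ
    t = m / 3
    2m<2[n+t+1] : 2 * m < 2 * suc (n + t)
    2m<2[n+t+1] = begin-strict
      2 * m                       ≡⟨ solve 1 (λ m → con 2 :* m := m :+ m) refl m ⟩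
      m + m                       ≤⟨ +-monoʳ-≤ m (m≤[m/3]*3+2 m) ⟩
      m + (t * 3 + 2)             ≡⟨ solve 2 (λ m t → m :+ (t :* con 3 :+ con 2)
                                                    := con 1 :+ (m :+ t) :+ (con 2 :* t :+ con 1)) refl m t ⟩
      suc (m + t) + (2 * t + 1)   ≤⟨ +-monoˡ-≤ (2 * t + 1) h ⟩
      2 * n + (2 * t + 1)         <⟨ +-monoʳ-< (2 * n) (+-monoʳ-< (2 * t) (n<1+n 1)) ⟩
      2 * n + (2 * t + 2)         ≡⟨ solve 2 (λ n t → con 2 :* n :+ (con 2 :* t :+ con 2)
                                                    := con 2 :* (con 1 :+ (n :+ t))) refl n t ⟩
      2 * suc (n + t)             ∎

forward backward : ℕ → Stage
forward  k = replicate k r01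
backward k = replicate k r10

shortInstance longInstance : ℕ → Instance
shortInstance k = forward k ∷ []
longInstance  k = (forward k ++ backward k) ∷ forward k ∷ []

shortInstance-IsOPT : ∀ k → IsOPT k (shortInstance k) k
shortInstance-IsOPT k =
    ((k , 0) ∷ [] ,
     (≤-reflexive (sym (count01-replicate-r01 k)) , z≤n , ≤-refl , z≤n , ≤-reflexive (+-identityʳ k) , tt) ,
     trans (+-identityʳ _) (+-identityʳ k))
  , λ c feas → subst (_ ≤_) (+-identityʳ k) (FeasibleFrom-profit-≤ (shortInstance k) c feas)

longInstance-IsOPT : ∀ k → IsOPT k (longInstance k) (2 * k)
longInstance-IsOPT k =
    ((0 , k) ∷ (k , 0) ∷ [] ,
     (z≤n , ≤-reflexive (sym count10-first) , z≤n , ≤-refl , ≤-refl ,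
      (≤-reflexive (sym (count01-replicate-r01 k)) , z≤n , m≤m+n k _ , z≤n , ≤-reflexive (+-identityʳ k) , tt)) ,
     cong (k +_) (+-identityʳ (k + 0)))
  , λ c feas → FeasibleFrom-profit-≤ (longInstance k) c feas
  where
    count10-first : count10 (forward k ++ backward k) ≡ k
    count10-first = trans (count10-++ (forward k) (backward k))
                          (cong₂ _+_ (count10-replicate-r01 k) (count10-replicate-r10 k))

accepted01 : OnlineAlg → ℕ → ℕ
accepted01 A k = proj₁ (runStage A [] [] (forward k))

profit-run-shortInstance : ∀ A k → Feasible k (shortInstance k) (run A (shortInstance k)) →
  profit (run A (shortInstance k)) ≡ accepted01 A k
profit-run-shortInstance A k (_ , r≤0 , _) =
  trans (+-identityʳ _) (trans (cong (accepted01 A k +_) r≡0) (+-identityʳ _))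
  where
    r≡0 : proj₂ (runStage A [] [] (forward k)) ≡ 0
    r≡0 = n≤0⇒n≡0 (subst (proj₂ (runStage A [] [] (forward k)) ≤_) (count10-replicate-r01 k) r≤0)

profit-run-longInstance-≤ : ∀ A k → Feasible k (longInstance k) (run A (longInstance k)) →
  k + k / 3 < 2 * accepted01 A k → profit (run A (longInstance k)) ≤ k + k / 3
profit-run-longInstance-≤ A k feas k+t<2x = +-cancelʳ-≤ ℓ₁ _ _ (begin
    profit (run A (longInstance k)) + ℓ₁  ≤⟨ two-stage-profit+ℓ₁-≤ (forward k ++ backward k) (forward k)
                                               feas (count10-replicate-r01 k) ⟩
    2 * k                                 ≡⟨ cong (k +_) (+-identityʳ k) ⟩
    k + k                                 ≤⟨ +-monoʳ-≤ k k≤ℓ₁+t ⟩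
    k + (ℓ₁ + t)                          ≡⟨ solve 3 (λ k l t → k :+ (l :+ t) := k :+ t :+ l) refl k ℓ₁ t ⟩
    k + t + ℓ₁                            ∎)
  where
    open ≤-Reasoning
    t : ℕ
    t = k / 3
    ℓ₁ : ℕ
    ℓ₁ = proj₁ (runStage A [] [] (forward k ++ backward k))
    k≤ℓ₁+t : k ≤ ℓ₁ + t
    k≤ℓ₁+t = ≤-trans (m+m/3<2*n⇒m≤n+m/3 k (accepted01 A k) k+t<2x)
                     (+-monoˡ-≤ t (runStage-proj₁-≤-++ A [] [] (forward k) (backward k)))

theorem10 : (k : ℕ) → 2 ≤ k → (A : OnlineAlg)
    → (∀ I → Feasible k I (run A I))
    → Σ Instance λ I → Σ ℕ λ o →
    IsOPT k I o × 0 < o × 2 * k * profit (run A I) ≤ (k + k / 3) * o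
theorem10 k 2≤k A feas with 2 * accepted01 A k ≤? k + k / 3
... | yes 2x≤k+t = shortInstance k , k , shortInstance-IsOPT k , 0<k , (begin
      2 * k * profit (run A (shortInstance k))  ≡⟨ cong (2 * k *_) (profit-run-shortInstance A k (feas (shortInstance k))) ⟩
      2 * k * accepted01 A k                    ≡⟨ *-assoc 2 k _ ⟩
      2 * (k * accepted01 A k)                  ≡⟨ cong (2 *_) (*-comm k _) ⟩
      2 * (accepted01 A k * k)                  ≡⟨ *-assoc 2 (accepted01 A k) k ⟨
      2 * accepted01 A k * k                    ≤⟨ *-monoˡ-≤ k 2x≤k+t ⟩
      (k + k / 3) * k                           ∎)
  where
    open ≤-Reasoning
    0<k : 0 < k
    0<k = ≤-trans (s≤s z≤n) 2≤k
... | no 2x≰k+t = longInstance k , 2 * k , longInstance-IsOPT k , 0<2k , (begin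
      2 * k * profit (run A (longInstance k))   ≤⟨ *-monoʳ-≤ (2 * k) (profit-run-longInstance-≤ A k (feas (longInstance k)) (≰⇒> 2x≰k+t)) ⟩
      2 * k * (k + k / 3)                       ≡⟨ *-comm (2 * k) _ ⟩
      (k + k / 3) * (2 * k)                     ∎)
  where
    open ≤-Reasoning
    0<2k : 0 < 2 * k
    0<2k = ≤-trans (s≤s z≤n) (≤-trans 2≤k (m≤m+n k _))
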